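{- For integers $q\ge1$, $k\ge 0$ and $d$, define \[ S_{q,d,k}=\sum_{\substack{k_1+\cdots+k_q=k\\ \forall j,\ 0\le k_j\le k-d}}\frac{\prod_{j=1}^{q}(2k_j-1)!!}{(2k-1)!!}. \] Then $S_{q,d,k}\le 3q$ for all sufficiently large $k$, all integers $q$ with $1\le q\le k$, and all integers $d$.
   Context: $(2j-1)!!=\frac{(2j)!}{2^jj!}$ for $j\ge0$; in particular $(-1)!!=1$. The sum runs over tuples $(k_1,\dots,k_q)$ of integers. -}

module Defs where

open import Data.Nat as ℕ using (ℕ; zero; suc; _+_; _*_; _∸_; NonZero)
import Data.Nat.Properties as NP
import Data.Nat.ListAction as NLA
import Data.Bool.ListAction as BLA
open import Data.Integer as ℤ using (ℤ; +_)
open import Data.Rational as ℚ using (ℚ)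
open import Data.List as List using (List; []; _∷_; concatMap; map; upTo; filter; foldr)
open import Data.Vec as Vec using (Vec; []; _∷_; toList)
open import Data.Bool using (Bool; true; false; _∧_)
open import Relation.Nullary.Decidable using (⌊_⌋)
open import Relation.Binary.PropositionalEquality using (_≡_)

-- oddDF n = (2n-1)!!  (so oddDF 0 = (-1)!! = 1)
oddDF : ℕ → ℕ
oddDF zero    = 1
oddDF (suc n) = suc (2 * n) * oddDF n

oddDF-nonZero : ∀ n → NonZero (oddDF n)
oddDF-nonZero zero = _
oddDF-nonZero (suc n) = NP.m*n≢0 (suc (2 * n)) (oddDF n) {{_}} {{oddDF-nonZero n}}

compositions : (q k : ℕ) → List (Vec ℕ q)
compositions zero zero    = [] ∷ []
compositions zero (suc k) = []
compositions (suc q) k =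
  concatMap (λ i → map (i ∷_) (compositions q (k ∸ i))) (upTo (suc k))

allBounded : ∀ {q} → ℕ → ℤ → Vec ℕ q → Bool
allBounded k d v = BLA.and (List.map (λ kj → ⌊ (+ kj) ℤ.≤? (+ k) ℤ.- d ⌋) (toList v))

prodDF : ∀ {q} → Vec ℕ q → ℕ
prodDF v = NLA.product (map oddDF (toList v))

S : (q : ℕ) → (d : ℤ) → (k : ℕ) → ℚ
S q d k = foldr ℚ._+_ ℚ.0ℚ
  (map (λ v → ℚ._/_ (+ prodDF v) (oddDF k) {{oddDF-nonZero k}})
       (List.filterᵇ (allBounded k d) (compositions q k)))

module Submission where

-- Write a i = (2i-1)!! and T q k for the sum of a k₁ ⋯ a k_q over
-- all compositions k₁ + ⋯ + k_q = k.  Dropping the constraint k_j ≤ k - d only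
-- enlarges S, so it suffices to show T q k ≤ 3 q a k whenever 1 ≤ q ≤ k
-- (hence K = 0 works).  T q is the q-th convolution power of a (T 0 = δ,
-- T (q+1) = a ⋆ T q), so we work in the semiring of ℕ-sequences under ⋆.
--   * With b i = a (i+1) one has a = δ + shift b, and the key estimate
--     (b ⋆ b) m ≤ 3 b m, obtained from the recursion b (i+1) = (2i+3) b i
--     and the Leibniz rule for the derivation f ↦ (i ↦ i f i).
--   * Call G controlled if a ⋆ G ≤ G + 3 shift G.  Controlled sequences are
--     closed under sums, scalars and shifts, and b is controlled; hence
--     T q ≤ δ + M q, where M 0 = 0, M (q+1) = shift b + M q + 3 shift (M q).
--   * An explicit envelope E q k, a combination of a k, a (k-1), a (k-2) with
--     polynomial coefficients in q, satisfies 2 M q k ≤ E q k ≤ 6 q a k for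
--     q ≤ k; both inequalities are polynomial identities plus slack.

open import Defs
open import Data.Nat using (ℕ; zero; suc; _+_; _*_; _∸_; _≤_; z≤n; s≤s; _≤?_; NonZero)
open import Data.Nat.Properties
open import Data.Nat.ListAction using (sum)
open import Data.Nat.ListAction.Properties using (sum-++)
open import Data.Integer using (ℤ; +_)
import Data.Integer as ℤ
import Data.Integer.Properties as ℤP
open import Data.Rational using (toℚᵘ) renaming (_≤_ to _≤ℚ_)
import Data.Rational as ℚ
import Data.Rational.Properties as ℚP
import Data.Rational.Unnormalised as ℚᵘ
import Data.Rational.Unnormalised.Properties as ℚᵘP
open import Data.List as List using (List; []; _∷_; concatMap; map; upTo; applyUpTo; foldr)
open import Data.List.Properties using (map-++; map-cong; map-∘; map-applyUpTo)
open import Data.Vec using (Vec; _∷_)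
open import Data.Bool using (Bool; true; false)
open import Data.Product using (Σ; _,_)
open import Function using (_∘_)
open import Relation.Binary.PropositionalEquality
open import Relation.Nullary.Decidable using (toWitness)
open import Data.Nat.Tactic.RingSolver using (solve-∀)

-- The convolution semiring of ℕ-sequences

Seq : Set
Seq = ℕ → ℕ

-- Cauchy product (f ⋆ g) n = Σ_{i ≤ n} f i · g (n - i), recursing on the head of f.
infixl 7 _⋆_
_⋆_ : Seq → Seq → Seq
(f ⋆ g) zero    = f 0 * g 0
(f ⋆ g) (suc n) = f 0 * g (suc n) + ((f ∘ suc) ⋆ g) n

δ : Seq
δ zero    = 1
δ (suc _) = 0

-- Multiplication by the formal variable X.
shift : Seq → Seq
shift f zero    = 0
shift f (suc n) = f n

⋆-congˡ : ∀ {f f′} g → (∀ i → f i ≡ f′ i) → ∀ n → (f ⋆ g) n ≡ (f′ ⋆ g) n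
⋆-congˡ g eq zero    = cong (_* g 0) (eq 0)
⋆-congˡ g eq (suc n) = cong₂ _+_ (cong (_* g (suc n)) (eq 0)) (⋆-congˡ g (eq ∘ suc) n)

⋆-monoʳ : ∀ f {g g′} → (∀ i → g i ≤ g′ i) → ∀ n → (f ⋆ g) n ≤ (f ⋆ g′) n
⋆-monoʳ f le zero    = *-monoʳ-≤ (f 0) (le 0)
⋆-monoʳ f le (suc n) = +-mono-≤ (*-monoʳ-≤ (f 0) (le (suc n))) (⋆-monoʳ (f ∘ suc) le n)

private
  interchange : ∀ x y z w → (x + y) + (z + w) ≡ (x + z) + (y + w)
  interchange = solve-∀

⋆-distribˡ-+ : ∀ f g h n → (f ⋆ (λ i → g i + h i)) n ≡ (f ⋆ g) n + (f ⋆ h) n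
⋆-distribˡ-+ f g h zero    = *-distribˡ-+ (f 0) (g 0) (h 0)
⋆-distribˡ-+ f g h (suc n) =
  trans (cong₂ _+_ (*-distribˡ-+ (f 0) (g (suc n)) (h (suc n))) (⋆-distribˡ-+ (f ∘ suc) g h n))
        (interchange (f 0 * g (suc n)) (f 0 * h (suc n)) ((f ∘ suc ⋆ g) n) ((f ∘ suc ⋆ h) n))

⋆-distribʳ-+ : ∀ f g h n → ((λ i → f i + g i) ⋆ h) n ≡ (f ⋆ h) n + (g ⋆ h) n
⋆-distribʳ-+ f g h zero    = *-distribʳ-+ (h 0) (f 0) (g 0)
⋆-distribʳ-+ f g h (suc n) =
  trans (cong₂ _+_ (*-distribʳ-+ (h (suc n)) (f 0) (g 0)) (⋆-distribʳ-+ (f ∘ suc) (g ∘ suc) h n))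
        (interchange (f 0 * h (suc n)) (g 0 * h (suc n)) ((f ∘ suc ⋆ h) n) ((g ∘ suc ⋆ h) n))

⋆-scaleʳ : ∀ f c g n → (f ⋆ (λ i → c * g i)) n ≡ c * (f ⋆ g) n
⋆-scaleʳ f c g zero    = *-left-comm (f 0) c (g 0)
  where *-left-comm : ∀ x y z → x * (y * z) ≡ y * (x * z)
        *-left-comm = solve-∀
⋆-scaleʳ f c g (suc n) =
  trans (cong (_+_ (f 0 * (c * g (suc n)))) (⋆-scaleʳ (f ∘ suc) c g n)) (regroup (f 0) c (g (suc n)) _)
  where regroup : ∀ x y z w → x * (y * z) + y * w ≡ y * (x * z + w)
        regroup = solve-∀

⋆-scaleˡ : ∀ c f g n → ((λ i → c * f i) ⋆ g) n ≡ c * (f ⋆ g) n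
⋆-scaleˡ c f g zero    = *-assoc c (f 0) (g 0)
⋆-scaleˡ c f g (suc n) =
  trans (cong (_+_ (c * f 0 * g (suc n))) (⋆-scaleˡ c (f ∘ suc) g n)) (regroup c (f 0) (g (suc n)) _)
  where regroup : ∀ x y z w → x * y * z + x * w ≡ x * (y * z + w)
        regroup = solve-∀

⋆-identityʳ : ∀ f n → (f ⋆ δ) n ≡ f n
⋆-identityʳ f zero    = *-identityʳ (f 0)
⋆-identityʳ f (suc n) = trans (cong (_+ ((f ∘ suc) ⋆ δ) n) (*-zeroʳ (f 0))) (⋆-identityʳ (f ∘ suc) n)

⋆-shiftʳ : ∀ f g n → (f ⋆ shift g) n ≡ shift (f ⋆ g) n
⋆-shiftʳ f g zero          = *-zeroʳ (f 0)
⋆-shiftʳ f g (suc zero)    = trans (cong (_+_ (f 0 * g 0)) (⋆-shiftʳ (f ∘ suc) g zero)) (+-identityʳ _)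
⋆-shiftʳ f g (suc (suc n)) = cong (_+_ (f 0 * g (suc n))) (⋆-shiftʳ (f ∘ suc) g (suc n))

⋆-unfold-last : ∀ f g n → (f ⋆ g) (suc n) ≡ f (suc n) * g 0 + (f ⋆ (g ∘ suc)) n
⋆-unfold-last f g zero    = +-comm (f 0 * g 1) (f 1 * g 0)
⋆-unfold-last f g (suc n) =
  trans (cong (_+_ (f 0 * g (suc (suc n)))) (⋆-unfold-last (f ∘ suc) g n)) (swap (f 0 * g (suc (suc n))) (f (suc (suc n)) * g 0) ((f ∘ suc ⋆ g ∘ suc) n))
  where swap : ∀ x y z → x + (y + z) ≡ y + (x + z)
        swap = solve-∀

⋆-comm : ∀ f g n → (f ⋆ g) n ≡ (g ⋆ f) n
⋆-comm f g zero    = *-comm (f 0) (g 0)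
⋆-comm f g (suc n) = trans (cong₂ _+_ (*-comm (f 0) (g (suc n))) (⋆-comm (f ∘ suc) g n))
                           (sym (⋆-unfold-last g f n))

deg : Seq → Seq
deg f i = i * f i

leibniz : ∀ f g n → (deg f ⋆ g) n + (f ⋆ deg g) n ≡ n * (f ⋆ g) n
leibniz f g zero    = *-zeroʳ (f 0)
leibniz f g (suc n) = begin
    (0 + (deg f ∘ suc ⋆ g) n) + (f 0 * (suc n * g (suc n)) + (f′ ⋆ deg g) n)
  ≡⟨ cong (λ z → (0 + z) + (f 0 * (suc n * g (suc n)) + (f′ ⋆ deg g) n)) (⋆-distribʳ-+ f′ (deg f′) g n) ⟩
    (0 + ((f′ ⋆ g) n + (deg f′ ⋆ g) n)) + (f 0 * (suc n * g (suc n)) + (f′ ⋆ deg g) n)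
  ≡⟨ regroup (f 0) (g (suc n)) n ((f′ ⋆ g) n) ((deg f′ ⋆ g) n) ((f′ ⋆ deg g) n) ⟩
    suc n * (f 0 * g (suc n)) + ((f′ ⋆ g) n + ((deg f′ ⋆ g) n + (f′ ⋆ deg g) n))
  ≡⟨ cong (λ z → suc n * (f 0 * g (suc n)) + ((f′ ⋆ g) n + z)) (leibniz f′ g n) ⟩
    suc n * (f 0 * g (suc n)) + ((f′ ⋆ g) n + n * (f′ ⋆ g) n)
  ≡⟨ sym (*-distribˡ-+ (suc n) (f 0 * g (suc n)) ((f′ ⋆ g) n)) ⟩
    suc n * (f 0 * g (suc n) + (f′ ⋆ g) n) ∎
  where
  open ≡-Reasoning
  f′ : Seq
  f′ = f ∘ suc
  regroup : ∀ x y n c d e → (0 + (c + d)) + (x * (suc n * y) + e) ≡ suc n * (x * y) + (c + (d + e))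
  regroup = solve-∀

-- Odd double factorials

a : Seq
a = oddDF

b : Seq
b = oddDF ∘ suc

a≡δ+shift-b : ∀ k → a k ≡ δ k + shift b k
a≡δ+shift-b zero    = refl
a≡δ+shift-b (suc k) = refl

-- b (i+1) = (2i+3) b i, written as 2 · deg b + 3 b.
b-suc : ∀ i → b (suc i) ≡ 2 * deg b i + 3 * b i
b-suc i = expand i (b i)
  where expand : ∀ i x → suc (2 * suc i) * x ≡ 2 * (i * x) + 3 * x
        expand = solve-∀

-- Recursion for b ⋆ b: by the Leibniz rule, 2 (deg b ⋆ b) m = m (b ⋆ b) m.
b⋆b-suc : ∀ m → (b ⋆ b) (suc m) ≡ b (suc m) + (m * (b ⋆ b) m + 3 * (b ⋆ b) m)
b⋆b-suc m = begin
    1 * b (suc m) + (b ∘ suc ⋆ b) m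
  ≡⟨ cong₂ _+_ (*-identityˡ (b (suc m))) (⋆-congˡ b b-suc m) ⟩
    b (suc m) + ((λ i → 2 * deg b i + 3 * b i) ⋆ b) m
  ≡⟨ cong (_+_ (b (suc m))) (⋆-distribʳ-+ (λ i → 2 * deg b i) (λ i → 3 * b i) b m) ⟩
    b (suc m) + (((λ i → 2 * deg b i) ⋆ b) m + ((λ i → 3 * b i) ⋆ b) m)
  ≡⟨ cong (_+_ (b (suc m))) (cong₂ _+_ (⋆-scaleˡ 2 (deg b) b m) (⋆-scaleˡ 3 b b m)) ⟩
    b (suc m) + (2 * (deg b ⋆ b) m + 3 * (b ⋆ b) m)
  ≡⟨ cong (λ z → b (suc m) + (z + 3 * (b ⋆ b) m)) twice-deg ⟩
    b (suc m) + (m * (b ⋆ b) m + 3 * (b ⋆ b) m) ∎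
  where
  open ≡-Reasoning
  twice-deg : 2 * (deg b ⋆ b) m ≡ m * (b ⋆ b) m
  twice-deg = begin
      2 * (deg b ⋆ b) m
    ≡⟨ cong (_+_ ((deg b ⋆ b) m)) (+-identityʳ _) ⟩
      (deg b ⋆ b) m + (deg b ⋆ b) m
    ≡⟨ cong (_+_ ((deg b ⋆ b) m)) (⋆-comm (deg b) b m) ⟩
      (deg b ⋆ b) m + (b ⋆ deg b) m
    ≡⟨ leibniz b b m ⟩
      m * (b ⋆ b) m ∎

-- Inductive step of the key estimate: for m ≥ 3 the recursion gives
-- (b ⋆ b)(m+1) ≤ b (m+1) + 3 (m+3) b m ≤ 3 (2m+3) b m = 3 b (m+1).
b⋆b≤3b-step : ∀ n → (b ⋆ b) (3 + n) ≤ 3 * b (3 + n) → (b ⋆ b) (4 + n) ≤ 3 * b (4 + n)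
b⋆b≤3b-step n ih = begin
    (b ⋆ b) (4 + n)
  ≡⟨ b⋆b-suc (3 + n) ⟩
    b (4 + n) + ((3 + n) * (b ⋆ b) (3 + n) + 3 * (b ⋆ b) (3 + n))
  ≤⟨ +-monoʳ-≤ (b (4 + n)) (+-mono-≤ (*-monoʳ-≤ (3 + n) ih) (*-monoʳ-≤ 3 ih)) ⟩
    b (4 + n) + ((3 + n) * (3 * x) + 3 * (3 * x))
  ≤⟨ m≤m+n _ (n * x) ⟩
    b (4 + n) + ((3 + n) * (3 * x) + 3 * (3 * x)) + n * x
  ≡⟨ identity n x ⟩
    3 * b (4 + n) ∎
  where
  open ≤-Reasoning
  x : ℕ
  x = b (3 + n)
  identity : ∀ n x → suc (2 * suc (3 + n)) * x + ((3 + n) * (3 * x) + 3 * (3 * x)) + n * x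
                     ≡ 3 * (suc (2 * suc (3 + n)) * x)
  identity = solve-∀

b⋆b≤3b : ∀ m → (b ⋆ b) m ≤ 3 * b m
b⋆b≤3b 0 = toWitness {a? = (b ⋆ b) 0 ≤? 3 * b 0} _
b⋆b≤3b 1 = toWitness {a? = (b ⋆ b) 1 ≤? 3 * b 1} _
b⋆b≤3b 2 = toWitness {a? = (b ⋆ b) 2 ≤? 3 * b 2} _
b⋆b≤3b 3 = toWitness {a? = (b ⋆ b) 3 ≤? 3 * b 3} _
b⋆b≤3b (suc (suc (suc (suc n)))) = b⋆b≤3b-step n (b⋆b≤3b (suc (suc (suc n))))

-- Sequences controlled by convolution with a

Controlled : Seq → Set
Controlled G = ∀ k → (a ⋆ G) k ≤ G k + 3 * shift G k

-- Since a = δ + shift b, this is the key estimate in disguise.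
controlled-b : Controlled b
controlled-b zero    = ≤-refl
controlled-b (suc j) = +-mono-≤ (≤-reflexive (*-identityˡ (b (suc j)))) (b⋆b≤3b j)

controlled-shift : ∀ {G} → Controlled G → Controlled (shift G)
controlled-shift {G} ctrl zero    = ≤-reflexive (*-zeroʳ (a 0))
controlled-shift {G} ctrl (suc k) = ≤-trans (≤-reflexive (⋆-shiftʳ a G (suc k))) (ctrl k)

controlled-zero : Controlled (λ _ → 0)
controlled-zero k = ≤-trans (≤-reflexive (⋆-scaleʳ a 0 (λ _ → 0) k)) z≤n

controlled-+ : ∀ {G H} → Controlled G → Controlled H → Controlled (λ i → G i + H i)
controlled-+ {G} {H} ctrlG ctrlH k = begin
    (a ⋆ (λ i → G i + H i)) k
  ≡⟨ ⋆-distribˡ-+ a G H k ⟩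
    (a ⋆ G) k + (a ⋆ H) k
  ≤⟨ +-mono-≤ (ctrlG k) (ctrlH k) ⟩
    G k + 3 * shift G k + (H k + 3 * shift H k)
  ≡⟨ regroup (G k) (H k) (shift G k) (shift H k) ⟩
    G k + H k + 3 * (shift G k + shift H k)
  ≡⟨ cong (λ z → G k + H k + 3 * z) (shift-+ k) ⟩
    G k + H k + 3 * shift (λ i → G i + H i) k ∎
  where
  open ≤-Reasoning
  regroup : ∀ x y z w → x + 3 * z + (y + 3 * w) ≡ x + y + 3 * (z + w)
  regroup = solve-∀
  shift-+ : ∀ k → shift G k + shift H k ≡ shift (λ i → G i + H i) k
  shift-+ zero    = refl
  shift-+ (suc k) = refl

controlled-scale : ∀ c {G} → Controlled G → Controlled (λ i → c * G i)
controlled-scale c {G} ctrl k = begin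
    (a ⋆ (λ i → c * G i)) k
  ≡⟨ ⋆-scaleʳ a c G k ⟩
    c * (a ⋆ G) k
  ≤⟨ *-monoʳ-≤ c (ctrl k) ⟩
    c * (G k + 3 * shift G k)
  ≡⟨ regroup c (G k) (shift G k) ⟩
    c * G k + 3 * (c * shift G k)
  ≡⟨ cong (λ z → c * G k + 3 * z) (shift-scale k) ⟩
    c * G k + 3 * shift (λ i → c * G i) k ∎
  where
  open ≤-Reasoning
  regroup : ∀ c x z → c * (x + 3 * z) ≡ c * x + 3 * (c * z)
  regroup = solve-∀
  shift-scale : ∀ k → c * shift G k ≡ shift (λ i → c * G i) k
  shift-scale zero    = *-zeroʳ c
  shift-scale (suc k) = refl

-- The majorant: M (q+1) = shift b + (1 + 3X) M q, so that a ⋆ (δ + M q) ≤ δ + M (q+1).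
M : ℕ → Seq
M zero    _ = 0
M (suc q) k = shift b k + M q k + 3 * shift (M q) k

controlled-M : ∀ q → Controlled (M q)
controlled-M zero    = controlled-zero
controlled-M (suc q) =
  controlled-+ (controlled-+ (controlled-shift controlled-b) (controlled-M q))
               (controlled-scale 3 (controlled-shift (controlled-M q)))

power : ℕ → Seq
power zero    = δ
power (suc q) = a ⋆ power q

power≤δ+M : ∀ q k → power q k ≤ δ k + M q k
power≤δ+M zero    k = m≤m+n (δ k) 0
power≤δ+M (suc q) k = begin
    (a ⋆ power q) k
  ≤⟨ ⋆-monoʳ a (power≤δ+M q) k ⟩
    (a ⋆ (λ i → δ i + M q i)) k
  ≡⟨ ⋆-distribˡ-+ a δ (M q) k ⟩
    (a ⋆ δ) k + (a ⋆ M q) k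
  ≤⟨ +-mono-≤ (≤-reflexive (trans (⋆-identityʳ a k) (a≡δ+shift-b k))) (controlled-M q k) ⟩
    δ k + shift b k + (M q k + 3 * shift (M q) k)
  ≡⟨ +-assoc (δ k) (shift b k) _ ⟩
    δ k + (shift b k + (M q k + 3 * shift (M q) k))
  ≡⟨ cong (_+_ (δ k)) (sym (+-assoc (shift b k) (M q k) _)) ⟩
    δ k + M (suc q) k ∎
  where open ≤-Reasoning

-- A closed-form envelope for the majorant

envelope : ℕ → Seq
envelope q k = 2 * q * a k + 3 * q * (q ∸ 1) * a (k ∸ 1) + 6 * q * (q ∸ 1) * (q ∸ 2) * a (k ∸ 2)

-- E satisfies the recursion of 2 M up to slack, as long as q ≤ k.  For q ≥ 2,
-- write k = q + t; the slack is an explicit polynomial in q and t times a (k-2).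
envelope-step : ∀ q k → q ≤ k → 2 * b k + envelope q (suc k) + 3 * envelope q k ≤ envelope (suc q) (suc k)
envelope-step zero k _ = ≤-reflexive (identity (b k))
  where identity : ∀ x → 2 * x + 0 + 3 * 0 ≡ 2 * 1 * x + 0 + 0
        identity = solve-∀
envelope-step (suc zero) (suc m) _ = ≤-reflexive (identity (a (suc (suc m))) (a (suc m)) (a m))
  where identity : ∀ x y z → 2 * x + (2 * 1 * x + 3 * 1 * 0 * y + 6 * 1 * 0 * 0 * z)
                             + 3 * (2 * 1 * y + 3 * 1 * 0 * z + 6 * 1 * 0 * 0 * z)
                             ≡ 2 * 2 * x + 3 * 2 * 1 * y + 6 * 2 * 1 * 0 * z
        identity = solve-∀
envelope-step (suc (suc r)) k q≤k with m≤n⇒∃[o]m+o≡n q≤k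
... | t , refl = ≤-trans (m≤m+n _ (a (r + t) * slack)) (≤-reflexive (identity r t (a (r + t))))
  where
  slack : ℕ
  slack = 27 * r + 9 * (r * r) + 54 * (r * t) + 18 * (r * r * t) + 18 + 36 * t
  identity : ∀ r t x →
    let m = r + t
        A0 = x
        A1 = suc (2 * m) * A0
        A2 = suc (2 * suc m) * A1
        A3 = suc (2 * suc (suc m)) * A2
    in 2 * A3 + (2 * suc (suc r) * A3 + 3 * suc (suc r) * suc r * A2 + 6 * suc (suc r) * suc r * r * A1)
         + 3 * (2 * suc (suc r) * A2 + 3 * suc (suc r) * suc r * A1 + 6 * suc (suc r) * suc r * r * A0)
       + x * (27 * r + 9 * (r * r) + 54 * (r * t) + 18 * (r * r * t) + 18 + 36 * t)
       ≡ 2 * suc (suc (suc r)) * A3 + 3 * suc (suc (suc r)) * suc (suc r) * A2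
         + 6 * suc (suc (suc r)) * suc (suc r) * suc r * A1
  identity = solve-∀

2M≤envelope : ∀ q k → q ≤ k → 2 * M q k ≤ envelope q k
2M≤envelope zero    k       _         = z≤n
2M≤envelope (suc q) (suc k) (s≤s q≤k) = begin
    2 * (shift b (suc k) + M q (suc k) + 3 * M q k)
  ≡⟨ distribute (b k) (M q (suc k)) (M q k) ⟩
    2 * b k + 2 * M q (suc k) + 3 * (2 * M q k)
  ≤⟨ +-mono-≤ (+-monoʳ-≤ (2 * b k) (2M≤envelope q (suc k) (m≤n⇒m≤1+n q≤k)))
              (*-monoʳ-≤ 3 (2M≤envelope q k q≤k)) ⟩
    2 * b k + envelope q (suc k) + 3 * envelope q k
  ≤⟨ envelope-step q k q≤k ⟩
    envelope (suc q) (suc k) ∎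
  where
  open ≤-Reasoning
  distribute : ∀ x y z → 2 * (x + y + 3 * z) ≡ 2 * x + 2 * y + 3 * (2 * z)
  distribute = solve-∀

-- For q ≤ k the lower-order terms are small: a (k-1) = a k / (2k-1), etc.
envelope≤6qa : ∀ q k → q ≤ k → envelope q k ≤ 6 * q * a k
envelope≤6qa zero          k _ = z≤n
envelope≤6qa (suc zero)    k _ = ≤-trans (≤-reflexive (identity (a k) (a (k ∸ 1)) (a (k ∸ 2))))
                                         (*-monoˡ-≤ (a k) {2} {6} (s≤s (s≤s z≤n)))
  where identity : ∀ x y z → 2 * 1 * x + 3 * 1 * 0 * y + 6 * 1 * 0 * 0 * z ≡ 2 * x
        identity = solve-∀
envelope≤6qa (suc (suc r)) k q≤k with m≤n⇒∃[o]m+o≡n q≤k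
... | t , refl = ≤-trans (m≤m+n _ (a (r + t) * suc (suc r) * slack)) (≤-reflexive (identity r t (a (r + t))))
  where
  slack : ℕ
  slack = 4 * (r * r) + 26 * (r * t) + 16 * (t * t) + 17 * r + 26 * t + 9
  identity : ∀ r t y →
    let m = r + t
        A1 = suc (2 * m) * y
        A2 = suc (2 * suc m) * A1
    in 2 * suc (suc r) * A2 + 3 * suc (suc r) * suc r * A1 + 6 * suc (suc r) * suc r * r * y
       + y * suc (suc r) * (4 * (r * r) + 26 * (r * t) + 16 * (t * t) + 17 * r + 26 * t + 9)
       ≡ 6 * suc (suc r) * A2
  identity = solve-∀

power≤3qa : ∀ q k → 1 ≤ q → q ≤ k → power q k ≤ 3 * q * a k
power≤3qa zero    zero    ()  _
power≤3qa (suc q) zero    _   ()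
power≤3qa q (suc k) _   q≤k = ≤-trans (power≤δ+M q (suc k)) (*-cancelˡ-≤ 2 (begin
    2 * M q (suc k)     ≤⟨ 2M≤envelope q (suc k) q≤k ⟩
    envelope q (suc k)  ≤⟨ envelope≤6qa q (suc k) q≤k ⟩
    6 * q * a (suc k)   ≡⟨ cong (_* a (suc k)) (*-assoc 2 3 q) ⟩
    2 * (3 * q) * a (suc k) ≡⟨ *-assoc 2 (3 * q) (a (suc k)) ⟩
    2 * (3 * q * a (suc k)) ∎))
  where open ≤-Reasoning

-- Sums over compositions are convolution powers

sum-map-concatMap : ∀ {A B : Set} (f : B → ℕ) (g : A → List B) xs →
  sum (map f (concatMap g xs)) ≡ sum (map (λ x → sum (map f (g x))) xs)
sum-map-concatMap f g []       = refl
sum-map-concatMap f g (x ∷ xs) = begin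
    sum (map f (g x List.++ concatMap g xs))
  ≡⟨ cong sum (map-++ f (g x) (concatMap g xs)) ⟩
    sum (map f (g x) List.++ map f (concatMap g xs))
  ≡⟨ sum-++ (map f (g x)) (map f (concatMap g xs)) ⟩
    sum (map f (g x)) + sum (map f (concatMap g xs))
  ≡⟨ cong (_+_ (sum (map f (g x)))) (sum-map-concatMap f g xs) ⟩
    sum (map f (g x)) + sum (map (λ x → sum (map f (g x))) xs) ∎
  where open ≡-Reasoning

sum-map-scale : ∀ {A : Set} (c : ℕ) (f : A → ℕ) xs → sum (map (λ x → c * f x) xs) ≡ c * sum (map f xs)
sum-map-scale c f []       = sym (*-zeroʳ c)
sum-map-scale c f (x ∷ xs) = trans (cong (_+_ (c * f x)) (sum-map-scale c f xs))
                                   (sym (*-distribˡ-+ c (f x) (sum (map f xs))))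

sum-range≡⋆ : ∀ f g n → sum (applyUpTo (λ i → f i * g (n ∸ i)) (suc n)) ≡ (f ⋆ g) n
sum-range≡⋆ f g zero    = +-identityʳ (f 0 * g 0)
sum-range≡⋆ f g (suc n) = cong (_+_ (f 0 * g (suc n))) (sum-range≡⋆ (f ∘ suc) g n)

sum-prodDF-cons : ∀ {q} i (L : List (Vec ℕ q)) → sum (map prodDF (map (i ∷_) L)) ≡ a i * sum (map prodDF L)
sum-prodDF-cons i L = trans (cong sum (sym (map-∘ L))) (sum-map-scale (a i) prodDF L)

compositionSum≡power : ∀ q k → sum (map prodDF (compositions q k)) ≡ power q k
compositionSum≡power zero    zero    = refl
compositionSum≡power zero    (suc k) = refl
compositionSum≡power (suc q) k       = begin
    sum (map prodDF (concatMap parts (upTo (suc k))))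
  ≡⟨ sum-map-concatMap prodDF parts (upTo (suc k)) ⟩
    sum (map (λ i → sum (map prodDF (parts i))) (upTo (suc k)))
  ≡⟨ cong sum (map-cong first-part (upTo (suc k))) ⟩
    sum (map (λ i → a i * power q (k ∸ i)) (upTo (suc k)))
  ≡⟨ cong sum (map-applyUpTo (λ i → i) (λ i → a i * power q (k ∸ i)) (suc k)) ⟩
    sum (applyUpTo (λ i → a i * power q (k ∸ i)) (suc k))
  ≡⟨ sum-range≡⋆ a (power q) k ⟩
    (a ⋆ power q) k ∎
  where
  open ≡-Reasoning
  parts : ℕ → List (Vec ℕ (suc q))
  parts i = map (i ∷_) (compositions q (k ∸ i))
  first-part : ∀ i → sum (map prodDF (parts i)) ≡ a i * power q (k ∸ i)
  first-part i = trans (sum-prodDF-cons i (compositions q (k ∸ i)))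
                       (cong (_*_ (a i)) (compositionSum≡power q (k ∸ i)))

sum-map-filter≤ : ∀ {A : Set} (f : A → ℕ) (P : A → Bool) xs →
  sum (map f (List.filterᵇ P xs)) ≤ sum (map f xs)
sum-map-filter≤ f P [] = ≤-refl
sum-map-filter≤ f P (x ∷ xs) with P x
... | true  = +-monoʳ-≤ (f x) (sum-map-filter≤ f P xs)
... | false = ≤-trans (sum-map-filter≤ f P xs) (m≤n+m _ (f x))

-- Transfer to ℚ

same-denominator-+ : ∀ m n D-1 →
  ℚᵘ.mkℚᵘ (+ m) D-1 ℚᵘ.+ ℚᵘ.mkℚᵘ (+ n) D-1 ℚᵘ.≃ ℚᵘ.mkℚᵘ (+ (m + n)) D-1
same-denominator-+ m n D-1 = ℚᵘ.*≡* (begin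
    (+ m ℤ.* + D ℤ.+ + n ℤ.* + D) ℤ.* + D
  ≡⟨ cong (ℤ._* + D) (cong₂ ℤ._+_ (sym (ℤP.pos-* m D)) (sym (ℤP.pos-* n D))) ⟩
    + (m * D + n * D) ℤ.* + D
  ≡⟨ sym (ℤP.pos-* (m * D + n * D) D) ⟩
    + ((m * D + n * D) * D)
  ≡⟨ cong +_ (regroup m n D) ⟩
    + ((m + n) * (D * D))
  ≡⟨ ℤP.pos-* (m + n) (D * D) ⟩
    + (m + n) ℤ.* + (D * D) ∎)
  where
  open ≡-Reasoning
  D : ℕ
  D = suc D-1
  regroup : ∀ m n D → (m * D + n * D) * D ≡ (m + n) * (D * D)
  regroup = solve-∀

sum-fractions : ∀ {A : Set} (f : A → ℕ) D-1 xs →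
  toℚᵘ (foldr ℚ._+_ ℚ.0ℚ (map (λ x → (+ f x) ℚ./ suc D-1) xs)) ℚᵘ.≃ ℚᵘ.mkℚᵘ (+ sum (map f xs)) D-1
sum-fractions f D-1 []       = ℚᵘ.*≡* refl
sum-fractions f D-1 (x ∷ xs) =
  ℚᵘP.≃-trans (ℚP.toℚᵘ-homo-+ ((+ f x) ℚ./ suc D-1) _)
    (ℚᵘP.≃-trans (ℚᵘP.+-cong (ℚP.toℚᵘ-fromℚᵘ (ℚᵘ.mkℚᵘ (+ f x) D-1)) (sum-fractions f D-1 xs))
                 (same-denominator-+ (f x) (sum (map f xs)) D-1))

sum-fractions≤ : ∀ {A : Set} (f : A → ℕ) xs (D : ℕ) .{{_ : NonZero D}} (N : ℕ) →
  sum (map f xs) ≤ N * D → foldr ℚ._+_ ℚ.0ℚ (map (λ x → (+ f x) ℚ./ D) xs) ≤ℚ (+ N) ℚ./ 1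
sum-fractions≤ f xs (suc D-1) N le = ℚP.toℚᵘ-cancel-≤
  (ℚᵘP.≤-respʳ-≃ (ℚᵘP.≃-sym (ℚP.toℚᵘ-fromℚᵘ (ℚᵘ.mkℚᵘ (+ N) 0)))
    (ℚᵘP.≤-respˡ-≃ (ℚᵘP.≃-sym (sum-fractions f D-1 xs)) (ℚᵘ.*≤* cross-multiplied)))
  where
  Σf : ℕ
  Σf = sum (map f xs)
  cross-multiplied : + Σf ℤ.* + 1 ℤ.≤ + N ℤ.* + suc D-1
  cross-multiplied = subst₂ ℤ._≤_ (ℤP.pos-* Σf 1) (ℤP.pos-* N (suc D-1))
                       (ℤ.+≤+ (≤-trans (≤-reflexive (*-identityʳ Σf)) le))

lemma20 : Σ ℕ λ K → (k : ℕ) → K ≤ k → (q : ℕ) → 1 ≤ q → q ≤ k → (d : ℤ) →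
              S q d k ≤ℚ (+ (3 * q) Data.Rational./ 1)
lemma20 = 0 , λ k _ q 1≤q q≤k d →
  sum-fractions≤ prodDF (List.filterᵇ (allBounded k d) (compositions q k)) (oddDF k) {{oddDF-nonZero k}} (3 * q)
    (begin
      sum (map prodDF (List.filterᵇ (allBounded k d) (compositions q k)))
    ≤⟨ sum-map-filter≤ prodDF (allBounded k d) (compositions q k) ⟩
      sum (map prodDF (compositions q k))
    ≡⟨ compositionSum≡power q k ⟩
      power q k
    ≤⟨ power≤3qa q k 1≤q q≤k ⟩
      3 * q * oddDF k ∎)
  where open ≤-Reasoning
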